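{- Let $\mathbf f$ be a metric energy and let $x^{\min}\in\mathbf L$ be such that $x^{\min}_s\in\{0,L\}$ for all $s\in\mathcal V$ and $(x^{\min},\mathbf L_{\rm top})$ is a strong autarky for $\mathbf f$, where $\mathbf L_{\rm top}$ is the labeling with all components $L$. Then every fixed point $x$ of the expansion-move algorithm for $\mathbf f$ satisfies $x\ge x^{\min}$ componentwise.
   Context: Let $\mathcal V$ be a finite set, $\mathcal E\subseteq\mathcal V\times\mathcal V$, $L\in\mathbb N$, $\mathcal L_s=\{0,\dots,L\}$ (natural order), $\mathbf L=\prod_s\mathcal L_s$, energy $\mathbf f(x)=f_0+\sum_sf_s(x_s)+\sum_{st\in\mathcal E}f_{st}(x_s,x_t)$. $\mathbf f$ is metric if each $f_{st}$ is a metric on $\{0,\dots,L\}$: $f_{st}(i,j)\ge0$, $f_{st}(i,j)=0$ iff $i=j$, $f_{st}(i,j)=f_{st}(j,i)$, $f_{st}(i,j)\le f_{st}(i,k)+f_{st}(k,j)$. Componentwise $(x\wedge y)_s=\min(x_s,y_s)$, $(x\vee y)_s=\max(x_s,y_s)$. A pair $(x^{\min},x^{\max})$ with $x^{\min}\le x^{\max}$ is a strong autarky for $\mathbf f$ if $\mathbf f((x\vee x^{\min})\wedge x^{\max})\le\mathbf f(x)$ for all $x\in\mathbf L$, strictly whenever $(x\vee x^{\min})\wedge x^{\max}\ne x$. Expansion move: for $x\in\mathbf L$ and label $k$, the move energy of $z\in\{0,1\}^{\mathcal V}$ is $\mathbf g_{x,k}(z)=g_0+\sum_sg_s(z_s)+\sum_{st}g_{st}(z_s,z_t)$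 with $g_0=f_0$, $g_s(0)=f_s(x_s)$, $g_s(1)=f_s(k)$, $g_{st}(0,0)=f_{st}(x_s,x_t)$, $g_{st}(0,1)=f_{st}(x_s,k)$, $g_{st}(1,0)=f_{st}(k,x_t)$, $g_{st}(1,1)=f_{st}(k,k)$; $\mathbf g_{x,k}(z)=\mathbf f(x')$ where $x'_s=x_s$ if $z_s=0$ and $x'_s=k$ if $z_s=1$. The algorithm replaces $x$ by such $x'$ for a minimizer $z^*$ of $\mathbf g_{x,k}$ whenever $\mathbf g_{x,k}(z^*)<\mathbf g_{x,k}(0)$. A labeling $x$ is a fixed point if for every label $k\in\{0,\dots,L\}$, $\min_z\mathbf g_{x,k}(z)=\mathbf g_{x,k}(0)$.
   Formalization: The energy terms $f_0$, $f_s$ and $f_{st}$ take values in the rationals rather than the reals. -}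

module Defs where

open import Data.Nat using (ℕ; zero; suc; _≤ᵇ_)
open import Data.Fin using (Fin; toℕ; fromℕ) renaming (zero to fzero; suc to fsuc)
import Data.Fin as F
open import Data.Bool using (Bool; true; false; if_then_else_)
open import Data.List using (List; foldr)
open import Data.Product using (_×_; _,_)
open import Data.Sum using (_⊎_)
open import Data.Rational using (ℚ; 0ℚ; _+_; _≤_; _<_)
open import Data.List.Membership.Propositional using (_∈_)
open import Relation.Binary.PropositionalEquality using (_≡_; _≢_)
open import Relation.Nullary using (¬_)

Label : ℕ → Set
Label L = Fin (suc L)

Labeling : ℕ → ℕ → Set
Labeling n L = Fin n → Label L

sumFin : (n : ℕ) → (Fin n → ℚ) → ℚ
sumFin zero    g = 0ℚ
sumFin (suc n) g = g fzero + sumFin n (λ i → g (fsuc i))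

record Energy (n L : ℕ) : Set where
  field
    edges : List (Fin n × Fin n)
    f₀    : ℚ
    unary : Fin n → Label L → ℚ
    pair  : Fin n → Fin n → Label L → Label L → ℚ

open Energy public

sumEdges : ∀ {n} → List (Fin n × Fin n) → (Fin n → Fin n → ℚ) → ℚ
sumEdges es h = foldr (λ { (s , t) acc → h s t + acc }) 0ℚ es

eval : ∀ {n L} → Energy n L → Labeling n L → ℚ
eval f x = f₀ f + sumFin _ (λ s → unary f s (x s))
               + sumEdges (edges f) (λ s t → pair f s t (x s) (x t))

IsMetric : ∀ {L} → (Label L → Label L → ℚ) → Set
IsMetric {L} d =
  (∀ i j → 0ℚ ≤ d i j) ×
  (∀ i j → (d i j ≡ 0ℚ → i ≡ j) × (i ≡ j → d i j ≡ 0ℚ)) ×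
  (∀ i j → d i j ≡ d j i) ×
  (∀ i j k → d i j ≤ d i k + d k j)

MetricEnergy : ∀ {n L} → Energy n L → Set
MetricEnergy f = ∀ s t → (s , t) ∈ edges f → IsMetric (pair f s t)

minL maxL : ∀ {L} → Label L → Label L → Label L
minL i j = if toℕ i ≤ᵇ toℕ j then i else j
maxL i j = if toℕ i ≤ᵇ toℕ j then j else i

_∧_ _∨_ : ∀ {n L} → Labeling n L → Labeling n L → Labeling n L
(x ∧ y) s = minL (x s) (y s)
(x ∨ y) s = maxL (x s) (y s)

_≤L_ : ∀ {n L} → Labeling n L → Labeling n L → Set
x ≤L y = ∀ s → x s F.≤ y s

_≡L_ : ∀ {n L} → Labeling n L → Labeling n L → Set
x ≡L y = ∀ s → x s ≡ y s

StrongAutarky : ∀ {n L} → Energy n L → Labeling n L → Labeling n L → Set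
StrongAutarky f xmin xmax =
  xmin ≤L xmax ×
  (∀ x → eval f ((x ∨ xmin) ∧ xmax) ≤ eval f x ×
         (¬ (((x ∨ xmin) ∧ xmax) ≡L x) → eval f ((x ∨ xmin) ∧ xmax) < eval f x))

Ltop : ∀ {n L} → Labeling n L
Ltop {L = L} _ = fromℕ L

moveEnergy : ∀ {n L} → Energy n L → Labeling n L → Label L → (Fin n → Bool) → ℚ
moveEnergy f x k z =
  f₀ f + sumFin _ (λ s → gs s (z s))
       + sumEdges (edges f) (λ s t → gst s t (z s) (z t))
  where
  gs : Fin _ → Bool → ℚ
  gs s false = unary f s (x s)
  gs s true  = unary f s k
  gst : Fin _ → Fin _ → Bool → Bool → ℚ
  gst s t false false = pair f s t (x s) (x t)
  gst s t false true  = pair f s t (x s) k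
  gst s t true  false = pair f s t k (x t)
  gst s t true  true  = pair f s t k k

zeroMove : ∀ {n} → Fin n → Bool
zeroMove _ = false

-- x is a fixed point of expansion move: for every k, min_z 𝐠_{x,k}(z) = 𝐠_{x,k}(0),
-- i.e. 𝐠_{x,k}(0) ≤ 𝐠_{x,k}(z) for all z (0 being one of the candidates).
FixedPoint : ∀ {n L} → Energy n L → Labeling n L → Set
FixedPoint f x = ∀ k z → moveEnergy f x k zeroMove ≤ moveEnergy f x k z

-- Since every x^min_s is 0 or L, clamping x into [x^min, L_top] sets x_s to L exactly
-- where x^min_s = L and leaves the other nodes alone: it is an expansion move with label L.
-- At a fixed point no expansion move lowers the energy, while the strong autarky makes the
-- clamp lower it strictly unless it changes nothing. Hence x is its own clamp, so x ≥ x^min.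
module Submission where

open import Defs
open import Data.Nat using (ℕ; zero; suc; _≤ᵇ_; z≤n)
open import Data.Nat.Properties using (≤ᵇ-reflects-≤; ≰⇒≥)
open import Data.Fin using (Fin; fromℕ; toℕ) renaming (zero to fzero)
import Data.Fin as F
open import Data.Fin.Properties using (_≟_; ≤-refl; ≤-antisym; ≤fromℕ; all?)
open import Data.Bool using (Bool; true; false; if_then_else_)
open import Data.List using (List; []; _∷_)
open import Data.Product using (_×_; _,_; proj₂)
open import Data.Sum using (_⊎_; inj₁; inj₂)
open import Data.Rational using (ℚ; _+_; _≤_)
open import Data.Rational.Properties using (<-irrefl; ≤-<-trans)
open import Relation.Nullary using (yes; no; does; contradiction)
open import Relation.Nullary.Decidable using (decidable-stable)
open import Relation.Nullary.Reflects using (ofʸ; ofⁿ)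
open import Relation.Binary.PropositionalEquality using (_≡_; refl; sym; trans; cong; cong₂; subst; module ≡-Reasoning)

private
  variable
    n L : ℕ

sumFin-cong : ∀ n {g h : Fin n → ℚ} → (∀ i → g i ≡ h i) → sumFin n g ≡ sumFin n h
sumFin-cong zero    g≗h = refl
sumFin-cong (suc n) g≗h = cong₂ _+_ (g≗h fzero) (sumFin-cong n (λ i → g≗h (F.suc i)))

sumEdges-cong : (es : List (Fin n × Fin n)) {g h : Fin n → Fin n → ℚ} →
                (∀ s t → g s t ≡ h s t) → sumEdges es g ≡ sumEdges es h
sumEdges-cong []             g≗h = refl
sumEdges-cong ((s , t) ∷ es) g≗h = cong₂ _+_ (g≗h s t) (sumEdges-cong es g≗h)

eval-cong : (f : Energy n L) {x y : Labeling n L} → x ≡L y → eval f x ≡ eval f y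
eval-cong f x≡y = cong₂ (λ u v → f₀ f + u + v)
  (sumFin-cong _ (λ s → cong (unary f s) (x≡y s)))
  (sumEdges-cong (edges f) (λ s t → cong₂ (pair f s t) (x≡y s) (x≡y t)))

expand : Labeling n L → Label L → (Fin n → Bool) → Labeling n L
expand x k z s = if z s then k else x s

-- moveEnergy's summands are local to its where block, so the left-hand sides of the helpers
-- are left to unification from their use in moveEnergy≡eval-expand; the with keeps the edge
-- list a variable so that this is a pattern problem.
mutual
  moveEnergy≡eval-expand : (f : Energy n L) (x : Labeling n L) (k : Label L) (z : Fin n → Bool) →
                           moveEnergy f x k z ≡ eval f (expand x k z)
  moveEnergy≡eval-expand f x k z with edges f
  ... | es = cong₂ (λ u v → f₀ f + u + v)
    (sumFin-cong _ (unaryTerm-expand f x k z))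
    (pairSum-expand f x k z es)

  unaryTerm-expand : (f : Energy n L) (x : Labeling n L) (k : Label L) (z : Fin n → Bool) (s : Fin n) →
                     _ ≡ unary f s (expand x k z s)
  unaryTerm-expand f x k z s with z s
  ... | false = refl
  ... | true  = refl

  pairSum-expand : (f : Energy n L) (x : Labeling n L) (k : Label L) (z : Fin n → Bool)
                   (es : List (Fin n × Fin n)) →
                   _ ≡ sumEdges es (λ s t → pair f s t (expand x k z s) (expand x k z t))
  pairSum-expand f x k z [] = refl
  pairSum-expand f x k z ((s , t) ∷ es) with z s | z t
  ... | false | false = cong (pair f s t (x s) (x t) +_) (pairSum-expand f x k z es)
  ... | false | true  = cong (pair f s t (x s) k +_) (pairSum-expand f x k z es)
  ... | true  | false = cong (pair f s t k (x t) +_) (pairSum-expand f x k z es)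
  ... | true  | true  = cong (pair f s t k k +_) (pairSum-expand f x k z es)

fixedPoint⇒eval≤expand : {f : Energy n L} {x : Labeling n L} → FixedPoint f x →
                         ∀ k z → eval f x ≤ eval f (expand x k z)
fixedPoint⇒eval≤expand {f = f} {x} fixed k z =
  subst (eval f x ≤_) (moveEnergy≡eval-expand f x k z) (fixed k z)

autarkyProjection-fixes-fixedPoint :
  {f : Energy n L} {xmin xmax x : Labeling n L} → FixedPoint f x → StrongAutarky f xmin xmax →
  ∀ k z → ((x ∨ xmin) ∧ xmax) ≡L expand x k z → ((x ∨ xmin) ∧ xmax) ≡L x
autarkyProjection-fixes-fixedPoint {f = f} {xmin} {xmax} {x} fixed (_ , autarky) k z isExpansion =
  decidable-stable (all? λ s → y s ≟ x s)
    (λ y≢x → <-irrefl refl (≤-<-trans x≤y (proj₂ (autarky x) y≢x)))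
  where
  y : Labeling _ _
  y = (x ∨ xmin) ∧ xmax
  x≤y : eval f x ≤ eval f y
  x≤y = subst (eval f x ≤_) (sym (eval-cong f isExpansion))
          (fixedPoint⇒eval≤expand {f = f} {x} fixed k z)

minL-≤ : {a b : Label L} → a F.≤ b → minL a b ≡ a
minL-≤ {a = a} {b} a≤b with toℕ a ≤ᵇ toℕ b | ≤ᵇ-reflects-≤ (toℕ a) (toℕ b)
... | true  | _        = refl
... | false | ofⁿ a≰b = contradiction a≤b a≰b

maxL-≤ : {a b : Label L} → a F.≤ b → maxL a b ≡ b
maxL-≤ {a = a} {b} a≤b with toℕ a ≤ᵇ toℕ b | ≤ᵇ-reflects-≤ (toℕ a) (toℕ b)
... | true  | _        = refl
... | false | ofⁿ a≰b = contradiction a≤b a≰b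

maxL-≥ : {a b : Label L} → b F.≤ a → maxL a b ≡ a
maxL-≥ {a = a} {b} b≤a with toℕ a ≤ᵇ toℕ b | ≤ᵇ-reflects-≤ (toℕ a) (toℕ b)
... | true  | ofʸ a≤b = ≤-antisym b≤a a≤b
... | false | _        = refl

minL-greatest : {a b c : Label L} → c F.≤ a → c F.≤ b → c F.≤ minL a b
minL-greatest {a = a} {b} c≤a c≤b with toℕ a ≤ᵇ toℕ b
... | true  = c≤a
... | false = c≤b

maxL-upperʳ : (a b : Label L) → b F.≤ maxL a b
maxL-upperʳ a b with toℕ a ≤ᵇ toℕ b | ≤ᵇ-reflects-≤ (toℕ a) (toℕ b)
... | true  | _        = ≤-refl
... | false | ofⁿ a≰b = ≰⇒≥ a≰b

≡L-projection⇒lowerBound : {xmin xmax x : Labeling n L} → xmin ≤L xmax →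
                           ((x ∨ xmin) ∧ xmax) ≡L x → xmin ≤L x
≡L-projection⇒lowerBound {xmin = xmin} {xmax} {x} xmin≤xmax fixes s =
  subst (xmin s F.≤_) (fixes s)
    (minL-greatest {a = maxL (x s) (xmin s)} (maxL-upperʳ (x s) (xmin s)) (xmin≤xmax s))

topNodes : Labeling n L → Fin n → Bool
topNodes {L = L} x s = does (x s ≟ fromℕ L)

clampTop-bottomOrTop : (a m : Label L) → m ≡ fzero ⊎ m ≡ fromℕ L →
                       minL (maxL a m) (fromℕ L) ≡ (if does (m ≟ fromℕ L) then fromℕ L else a)
clampTop-bottomOrTop {L} a m bottomOrTop with m ≟ fromℕ L
... | yes refl = begin
  minL (maxL a (fromℕ L)) (fromℕ L) ≡⟨ cong (λ u → minL u (fromℕ L)) (maxL-≤ {a = a} (≤fromℕ a)) ⟩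
  minL (fromℕ L) (fromℕ L)          ≡⟨ minL-≤ {a = fromℕ L} ≤-refl ⟩
  fromℕ L                           ∎
  where open ≡-Reasoning
... | no m≢top with bottomOrTop
...   | inj₂ m≡top = contradiction m≡top m≢top
...   | inj₁ refl  =
  trans (cong (λ u → minL u (fromℕ L)) (maxL-≥ {a = a} {fzero} z≤n)) (minL-≤ {a = a} (≤fromℕ a))

clampTop≡expand : {xmin : Labeling n L} → (∀ s → xmin s ≡ fzero ⊎ xmin s ≡ fromℕ L) →
                  (x : Labeling n L) → ((x ∨ xmin) ∧ Ltop) ≡L expand x (fromℕ L) (topNodes xmin)
clampTop≡expand {xmin = xmin} bottomOrTop x s = clampTop-bottomOrTop (x s) (xmin s) (bottomOrTop s)

mainTheorem10 : (n L : ℕ) (f : Energy n L) → MetricEnergy f →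
    (xmin : Labeling n L) →
    (∀ s → xmin s ≡ fzero ⊎ xmin s ≡ fromℕ L) →
    StrongAutarky f xmin Ltop →
    (x : Labeling n L) → FixedPoint f x → xmin ≤L x
mainTheorem10 n L f _ xmin bottomOrTop autarky@(xmin≤top , _) x fixed =
  ≡L-projection⇒lowerBound xmin≤top
    (autarkyProjection-fixes-fixedPoint {f = f} fixed autarky (fromℕ L) (topNodes xmin)
      (clampTop≡expand bottomOrTop x))
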